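{- Let $A$ be a real $n\times n$ matrix, $P=I-\frac1n\mathbf{1}\mathbf{1}'$ and $S=PAP$. Let $\Omega_1,\Omega_2\subseteq\{1,\dots,n\}$ be non-empty with $|\Omega_1|=|\Omega_2|$. Then $\operatorname{cofsum}(A)=\operatorname{cofsum}(S)$ and $\operatorname{cofsum}(A[\Omega_1,\Omega_2])=\operatorname{cofsum}(S[\Omega_1,\Omega_2])$.
   Context: $\mathbf{1}$ is the all-ones vector in $\mathbb{R}^n$. $W[\Omega_1,\Omega_2]$ is the submatrix of $W$ with rows indexed by $\Omega_1$ and columns by $\Omega_2$. $\operatorname{cofsum}(B)$ is the sum of all cofactors of the square matrix $B$, i.e. $\mathbf{1}'\operatorname{adj}(B)\mathbf{1}$ with $\operatorname{adj}$ the classical adjoint. -}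

module Defs where

open import Level using (Level)
open import Data.Nat using (ℕ; zero; suc)
open import Data.Fin using (Fin; zero; suc; punchIn; _<_; toℕ)
open import Algebra.Bundles using (CommutativeRing)

Matrix : ∀ {a} → Set a → ℕ → ℕ → Set a
Matrix A m n = Fin m → Fin n → A

-- Strictly increasing index map: an enumeration (in increasing order) of a
-- k-element subset of {1,…,n}.  Subsets Ω ⊆ {1..n} with |Ω| = k are in
-- bijection with such maps.
StrictlyIncreasing : ∀ {k n} → (Fin k → Fin n) → Set
StrictlyIncreasing f = ∀ i j → i < j → f i < f j

module _ {c ℓ : Level} (R : CommutativeRing c ℓ) where
  open CommutativeRing R hiding (zero)

  Σ : ∀ n → (Fin n → Carrier) → Carrier
  Σ zero    f = 0#
  Σ (suc n) f = f zero + Σ n (λ i → f (suc i))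

  fromℕ : ℕ → Carrier
  fromℕ zero    = 0#
  fromℕ (suc m) = 1# + fromℕ m

  sgn : ℕ → Carrier
  sgn zero    = 1#
  sgn (suc m) = - sgn m

  minor : ∀ {n} → Matrix Carrier (suc n) (suc n) → Fin (suc n) → Fin (suc n)
        → Matrix Carrier n n
  minor M i j r s = M (punchIn i r) (punchIn j s)

  det : ∀ n → Matrix Carrier n n → Carrier
  det zero    M = 1#
  det (suc n) M = Σ (suc n) (λ j → sgn (toℕ j) * (M zero j * det n (minor M zero j)))

  cofactor : ∀ {n} → Matrix Carrier (suc n) (suc n) → Fin (suc n) → Fin (suc n) → Carrier
  cofactor {n} M i j = sgn (toℕ i Data.Nat.+ toℕ j) * det n (minor M i j)

  adj : ∀ n → Matrix Carrier n n → Matrix Carrier n n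
  adj zero    M ()
  adj (suc n) M i j = cofactor M j i

  cofsum : ∀ n → Matrix Carrier n n → Carrier
  cofsum n M = Σ n (λ i → Σ n (λ j → adj n M i j))

  _⊗_ : ∀ {m n p} → Matrix Carrier m n → Matrix Carrier n p → Matrix Carrier m p
  _⊗_ {n = n} M N i k = Σ n (λ j → M i j * N j k)

  δ : ∀ {n} → Fin n → Fin n → Carrier
  δ zero    zero    = 1#
  δ zero    (suc j) = 0#
  δ (suc i) zero    = 0#
  δ (suc i) (suc j) = δ i j

  -- centering matrix P = I - (1/n) 1 1', given ninv with n · ninv = 1
  centering : ∀ n → Carrier → Matrix Carrier n n
  centering n ninv i j = δ i j - ninv

  centered : ∀ n → Carrier → Matrix Carrier n n → Matrix Carrier n n
  centered n ninv A = (centering n ninv ⊗ A) ⊗ centering n ninv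

  submatrix : ∀ {m n k l} → Matrix Carrier m n → (Fin k → Fin m) → (Fin l → Fin n)
            → Matrix Carrier k l
  submatrix W f g r s = W (f r) (g s)

-- Multiplying by P on the left (right) adds to A a matrix with constant
-- columns (rows), i.e. a rank-one matrix 1 vᵀ (u 1ᵀ), and the same holds for
-- every submatrix.  The cofactor sum is invariant under such perturbations:
-- by the matrix determinant lemma det (B + x yᵀ) = det B + yᵀ adj(B) x, so
-- cofsum B = det (B + 1 1ᵀ) - det B, and expanding det (B + u 1ᵀ + 1 1ᵀ) in
-- two ways gives cofsum (B + u 1ᵀ) = cofsum B.  The determinant lemma is
-- proved by induction along the first row; it needs Laplace expansion along
-- an arbitrary row and the vanishing of determinants with two equal rows, and
-- both come from expanding along two rows at once and comparing the two terms
-- that use the same pair of columns.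

module Submission where

open import Defs
open import Level using (Level)
open import Data.Nat using (ℕ; zero; suc) renaming (_+_ to _+ℕ_)
open import Data.Fin using (Fin; zero; suc; punchIn; toℕ)
open import Data.Fin.Properties using (punchInᵢ≢i; suc-injective)
open import Data.Vec.Functional using (updateAt)
open import Data.Vec.Functional.Properties
  using (updateAt-updates; updateAt-minimal; map-updateAt-local)
open import Data.Product using (_×_; _,_)
open import Data.Empty using (⊥-elim)
open import Function using (id; const; _∘_)
open import Algebra.Bundles using (CommutativeRing)
import Relation.Binary.PropositionalEquality as ≡
open ≡ using (_≡_; _≢_)

-- punchOut′ i j is the position of j once i is deleted: a total version of
-- punchOut, with a junk value at j = i.
punchOut′ : ∀ {n} → Fin (suc (suc n)) → Fin (suc (suc n)) → Fin (suc n)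
punchOut′         zero    zero    = zero
punchOut′         zero    (suc j) = j
punchOut′         (suc i) zero    = zero
punchOut′ {zero}  (suc i) (suc j) = zero
punchOut′ {suc n} (suc i) (suc j) = suc (punchOut′ i j)

punchOut′-punchIn : ∀ {n} (i : Fin (suc (suc n))) (j : Fin (suc n)) →
                    punchOut′ i (punchIn i j) ≡ j
punchOut′-punchIn         zero    j       = ≡.refl
punchOut′-punchIn         (suc i) zero    = ≡.refl
punchOut′-punchIn {suc n} (suc i) (suc j) = ≡.cong suc (punchOut′-punchIn i j)

punchIn-punchOut′-comm : ∀ {n} (i j : Fin (suc (suc n))) → i ≢ j → ∀ k →
  punchIn i (punchIn (punchOut′ i j) k) ≡ punchIn j (punchIn (punchOut′ j i) k)
punchIn-punchOut′-comm         zero    zero    i≢j k       = ⊥-elim (i≢j ≡.refl)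
punchIn-punchOut′-comm         zero    (suc j) i≢j k       = ≡.refl
punchIn-punchOut′-comm         (suc i) zero    i≢j k       = ≡.refl
punchIn-punchOut′-comm {suc n} (suc i) (suc j) i≢j zero    = ≡.refl
punchIn-punchOut′-comm {suc n} (suc i) (suc j) i≢j (suc k) =
  ≡.cong suc (punchIn-punchOut′-comm i j (i≢j ∘ ≡.cong suc) k)

module Cofactors {c ℓ : Level} (R : CommutativeRing c ℓ) where
  open CommutativeRing R hiding (zero)
  open import Algebra.Properties.Ring ring
    using (-0#≈0#; -‿involutive; -‿distribˡ-*; -‿distribʳ-*; -‿+-comm; +-cancelˡ)
  open import Algebra.Properties.CommutativeSemigroup +-commutativeSemigroup
    using (interchange) renaming (x∙yz≈y∙xz to x+yz≈y+xz)
  open import Algebra.Properties.CommutativeSemigroup *-commutativeSemigroup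
    using () renaming (x∙yz≈y∙xz to x*yz≈y*xz)
  open import Algebra.Solver.Ring.NaturalCoefficients.Default commutativeSemiring
  open import Relation.Binary.Reasoning.Setoid setoid

  Mat : ℕ → Set c
  Mat n = Matrix Carrier n n

  Σ-cong : ∀ n {f g : Fin n → Carrier} → (∀ i → f i ≈ g i) → Σ R n f ≈ Σ R n g
  Σ-cong zero    f≈g = refl
  Σ-cong (suc n) f≈g = +-cong (f≈g zero) (Σ-cong n (f≈g ∘ suc))

  Σ-distrib-+ : ∀ n (f g : Fin n → Carrier) →
                Σ R n (λ i → f i + g i) ≈ Σ R n f + Σ R n g
  Σ-distrib-+ zero    f g = sym (+-identityˡ 0#)
  Σ-distrib-+ (suc n) f g =
    trans (+-congˡ (Σ-distrib-+ n (f ∘ suc) (g ∘ suc))) (interchange _ _ _ _)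

  *-distribˡ-Σ : ∀ n a (f : Fin n → Carrier) → a * Σ R n f ≈ Σ R n (λ i → a * f i)
  *-distribˡ-Σ zero    a f = zeroʳ a
  *-distribˡ-Σ (suc n) a f = trans (distribˡ a _ _) (+-congˡ (*-distribˡ-Σ n a (f ∘ suc)))

  Σ-neg : ∀ n (f : Fin n → Carrier) → Σ R n (λ i → - f i) ≈ - Σ R n f
  Σ-neg zero    f = sym -0#≈0#
  Σ-neg (suc n) f = trans (+-congˡ (Σ-neg n (f ∘ suc))) (-‿+-comm _ _)

  Σ-zero : ∀ n (f : Fin n → Carrier) → (∀ i → f i ≈ 0#) → Σ R n f ≈ 0#
  Σ-zero zero    f f≈0 = refl
  Σ-zero (suc n) f f≈0 = trans (+-cong (f≈0 zero) (Σ-zero n (f ∘ suc) (f≈0 ∘ suc))) (+-identityˡ 0#)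

  Σ-comm : ∀ m n (f : Fin m → Fin n → Carrier) →
           Σ R m (λ i → Σ R n (f i)) ≈ Σ R n (λ j → Σ R m (λ i → f i j))
  Σ-comm zero    n f = sym (Σ-zero n _ (λ _ → refl))
  Σ-comm (suc m) n f =
    trans (+-congˡ (Σ-comm m n (f ∘ suc))) (sym (Σ-distrib-+ n (f zero) _))

  Σ-interchange : ∀ m n (a b : Fin m → Carrier) (x : Fin n → Carrier) (U : Fin m → Fin n → Carrier) →
                  Σ R m (λ c → a c * (b c * Σ R n (λ i → x i * U c i)))
                  ≈ Σ R n (λ i → x i * Σ R m (λ c → a c * (b c * U c i)))
  Σ-interchange m n a b x U = begin
    Σ R m (λ c → a c * (b c * Σ R n (λ i → x i * U c i)))
      ≈⟨ Σ-cong m (λ c → trans (*-congˡ (*-distribˡ-Σ n (b c) _)) (*-distribˡ-Σ n (a c) _)) ⟩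
    Σ R m (λ c → Σ R n (λ i → a c * (b c * (x i * U c i))))
      ≈⟨ Σ-cong m (λ c → Σ-cong n (λ i → rearrange (a c) (b c) (x i) (U c i))) ⟩
    Σ R m (λ c → Σ R n (λ i → x i * (a c * (b c * U c i))))
      ≈⟨ Σ-comm m n _ ⟩
    Σ R n (λ i → Σ R m (λ c → x i * (a c * (b c * U c i))))
      ≈⟨ Σ-cong n (λ i → *-distribˡ-Σ m (x i) _) ⟨
    Σ R n (λ i → x i * Σ R m (λ c → a c * (b c * U c i))) ∎
    where
    rearrange : ∀ a b x u → a * (b * (x * u)) ≈ x * (a * (b * u))
    rearrange = solve 4 (λ a b x u → a :* (b :* (x :* u)) := x :* (a :* (b :* u))) refl

  Σ-δˡ : ∀ n (i : Fin n) (f : Fin n → Carrier) → Σ R n (λ l → δ R i l * f l) ≈ f i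
  Σ-δˡ (suc n) zero f =
    trans (+-cong (*-identityˡ _) (Σ-zero n _ (λ l → zeroˡ _))) (+-identityʳ _)
  Σ-δˡ (suc n) (suc i) f = trans (+-cong (zeroˡ _) (Σ-δˡ n i (f ∘ suc))) (+-identityˡ _)

  Σ-δʳ : ∀ n (j : Fin n) (f : Fin n → Carrier) → Σ R n (λ l → f l * δ R l j) ≈ f j
  Σ-δʳ (suc n) zero f =
    trans (+-cong (*-identityʳ _) (Σ-zero n _ (λ l → zeroʳ _))) (+-identityʳ _)
  Σ-δʳ (suc n) (suc j) f = trans (+-cong (zeroʳ _) (Σ-δʳ n j (f ∘ suc))) (+-identityˡ _)

  offDiagonal : ∀ m → (Fin (suc m) → Fin (suc m) → Carrier) → Carrier
  offDiagonal m h = Σ R (suc m) (λ c → Σ R m (λ d → h c (punchIn c d)))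

  Σ-offDiagonal-transpose : ∀ m (h : Fin (suc m) → Fin (suc m) → Carrier) →
                            offDiagonal m h ≈ offDiagonal m (λ c c′ → h c′ c)
  Σ-offDiagonal-transpose zero    h = refl
  Σ-offDiagonal-transpose (suc m) h = begin
    row₀ + Σ R (suc m) (λ c → h (suc c) zero + Σ R m (λ d → h′ c (punchIn c d)))
      ≈⟨ +-congˡ (Σ-distrib-+ (suc m) (λ c → h (suc c) zero) (λ c → Σ R m (λ d → h′ c (punchIn c d)))) ⟩
    row₀ + (column₀ + offDiagonal m h′)
      ≈⟨ x+yz≈y+xz _ _ _ ⟩
    column₀ + (row₀ + offDiagonal m h′)
      ≈⟨ +-congˡ (+-congˡ (Σ-offDiagonal-transpose m h′)) ⟩
    column₀ + (row₀ + offDiagonal m (λ c c′ → h′ c′ c))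
      ≈⟨ +-congˡ (Σ-distrib-+ (suc m) (λ c → h zero (suc c)) (λ c → Σ R m (λ d → h′ (punchIn c d) c))) ⟨
    column₀ + Σ R (suc m) (λ c → h zero (suc c) + Σ R m (λ d → h′ (punchIn c d) c)) ∎
    where
    h′ : Fin (suc m) → Fin (suc m) → Carrier
    h′ c c′ = h (suc c) (suc c′)
    row₀ column₀ : Carrier
    row₀    = Σ R (suc m) (λ d → h zero (suc d))
    column₀ = Σ R (suc m) (λ c → h (suc c) zero)

  Σ-offDiagonal-antisym : ∀ m (h : Fin (suc m) → Fin (suc m) → Carrier) →
                          (∀ c c′ → c ≢ c′ → h c c′ + h c′ c ≈ 0#) → offDiagonal m h ≈ 0#
  Σ-offDiagonal-antisym zero    h skew = +-identityʳ 0#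
  Σ-offDiagonal-antisym (suc m) h skew = begin
    row₀ + Σ R (suc m) (λ c → h (suc c) zero + Σ R m (λ d → h′ c (punchIn c d)))
      ≈⟨ +-congˡ (Σ-distrib-+ (suc m) (λ c → h (suc c) zero) (λ c → Σ R m (λ d → h′ c (punchIn c d)))) ⟩
    row₀ + (column₀ + offDiagonal m h′)
      ≈⟨ +-assoc _ _ _ ⟨
    (row₀ + column₀) + offDiagonal m h′
      ≈⟨ +-cong row₀+column₀≈0 (Σ-offDiagonal-antisym m h′ (λ c c′ c≢c′ → skew _ _ (c≢c′ ∘ suc-injective))) ⟩
    0# + 0#
      ≈⟨ +-identityʳ 0# ⟩
    0# ∎
    where
    h′ : Fin (suc m) → Fin (suc m) → Carrier
    h′ c c′ = h (suc c) (suc c′)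
    row₀ column₀ : Carrier
    row₀    = Σ R (suc m) (λ d → h zero (suc d))
    column₀ = Σ R (suc m) (λ c → h (suc c) zero)
    row₀+column₀≈0 : row₀ + column₀ ≈ 0#
    row₀+column₀≈0 = trans (sym (Σ-distrib-+ (suc m) (λ d → h zero (suc d)) (λ c → h (suc c) zero)))
                           (Σ-zero (suc m) _ (λ c → skew zero (suc c) (λ ())))

  -- Laplace expansion along any row

  sgnᶠ : ∀ {n} → Fin n → Carrier
  sgnᶠ i = sgn R (toℕ i)

  -x*-y≈x*y : ∀ x y → - x * - y ≈ x * y
  -x*-y≈x*y x y = begin
    - x * - y     ≈⟨ -‿distribˡ-* x (- y) ⟨
    - (x * - y)   ≈⟨ -‿cong (-‿distribʳ-* x y) ⟨
    - - (x * y)   ≈⟨ -‿involutive _ ⟩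
    x * y         ∎

  sgn-+ : ∀ a b → sgn R (a +ℕ b) ≈ sgn R a * sgn R b
  sgn-+ zero    b = sym (*-identityˡ _)
  sgn-+ (suc a) b = trans (-‿cong (sgn-+ a b)) (-‿distribˡ-* _ _)

  sgnᶠ-punchOut′-antisym : ∀ {n} (i j : Fin (suc (suc n))) → i ≢ j →
                   sgnᶠ i * sgnᶠ (punchOut′ i j) ≈ - (sgnᶠ j * sgnᶠ (punchOut′ j i))
  sgnᶠ-punchOut′-antisym zero zero i≢j = ⊥-elim (i≢j ≡.refl)
  sgnᶠ-punchOut′-antisym zero (suc j) i≢j = begin
    1# * sgnᶠ j        ≈⟨ *-identityˡ _ ⟩
    sgnᶠ j             ≈⟨ -‿involutive _ ⟨
    - - sgnᶠ j         ≈⟨ -‿cong (*-identityʳ _) ⟨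
    - (- sgnᶠ j * 1#)  ∎
  sgnᶠ-punchOut′-antisym (suc i) zero i≢j = begin
    - sgnᶠ i * 1#      ≈⟨ *-identityʳ _ ⟩
    - sgnᶠ i           ≈⟨ -‿cong (*-identityˡ _) ⟨
    - (1# * sgnᶠ i)    ∎
  sgnᶠ-punchOut′-antisym {zero} (suc zero) (suc zero) i≢j = ⊥-elim (i≢j ≡.refl)
  sgnᶠ-punchOut′-antisym {suc n} (suc i) (suc j) i≢j = begin
    - sgnᶠ i * - sgnᶠ (punchOut′ i j)       ≈⟨ -x*-y≈x*y _ _ ⟩
    sgnᶠ i * sgnᶠ (punchOut′ i j)           ≈⟨ sgnᶠ-punchOut′-antisym i j (i≢j ∘ ≡.cong suc) ⟩
    - (sgnᶠ j * sgnᶠ (punchOut′ j i))       ≈⟨ -‿cong (-x*-y≈x*y _ _) ⟨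
    - (- sgnᶠ j * - sgnᶠ (punchOut′ j i))   ∎

  det-cong : ∀ n {A B : Mat n} → (∀ i j → A i j ≈ B i j) → det R n A ≈ det R n B
  det-cong zero    A≈B = refl
  det-cong (suc n) A≈B = Σ-cong (suc n) (λ j → *-congˡ {sgnᶠ j} (*-cong (A≈B zero j)
    (det-cong n (λ r s → A≈B (punchIn zero r) (punchIn j s)))))

  _[_]≔_ : ∀ {n} → Mat n → Fin n → (Fin n → Carrier) → Mat n
  B [ i ]≔ y = updateAt B i (const y)

  -- Definitionally both minor (minor B 0 c) i d and minor (minor B (suc i) c) 0 d.
  minor₂ : ∀ {n} → Mat (suc (suc n)) → Fin (suc n) → Fin (suc (suc n)) → Fin (suc n) → Mat n
  minor₂ B i c d r s = B (suc (punchIn i r)) (punchIn c (punchIn d s))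

  -- The term of the expansion of det B along row 0 (entries u) and row suc i
  -- (entries v) in which these rows use columns c and c′ respectively.
  pairTerm : ∀ {n} → Mat (suc (suc n)) → Fin (suc n) → (u v : Fin (suc (suc n)) → Carrier) →
             Fin (suc (suc n)) → Fin (suc (suc n)) → Carrier
  pairTerm {n} B i u v c c′ =
    (sgnᶠ i * (sgnᶠ c * sgnᶠ (punchOut′ c c′))) * ((u c * v c′) * det R n (minor₂ B i c (punchOut′ c c′)))

  pairTerm-punchIn : ∀ {n} (B : Mat (suc (suc n))) i u v c d →
    pairTerm B i u v c (punchIn c d)
    ≈ (sgnᶠ i * (sgnᶠ c * sgnᶠ d)) * ((u c * v (punchIn c d)) * det R n (minor₂ B i c d))
  pairTerm-punchIn {n} B i u v c d = reflexive (≡.cong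
    (λ e → (sgnᶠ i * (sgnᶠ c * sgnᶠ e)) * ((u c * v (punchIn c d)) * det R n (minor₂ B i c e)))
    (punchOut′-punchIn c d))

  pairTerm-antisym : ∀ {n} (B : Mat (suc (suc n))) i u v {c c′} → c ≢ c′ →
                     pairTerm B i u v c′ c ≈ - pairTerm B i v u c c′
  pairTerm-antisym {n} B i u v {c} {c′} c≢c′ = begin
    (sgnᶠ i * (sgnᶠ c′ * sgnᶠ (punchOut′ c′ c))) * ((u c′ * v c) * det R n (minor₂ B i c′ (punchOut′ c′ c)))
      ≈⟨ *-cong (*-congˡ (sgnᶠ-punchOut′-antisym c′ c (c≢c′ ∘ ≡.sym))) (*-cong (*-comm _ _) (det-cong n minor₂-comm)) ⟩
    (sgnᶠ i * - σ) * ((v c * u c′) * det R n (minor₂ B i c (punchOut′ c c′)))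
      ≈⟨ *-congʳ (-‿distribʳ-* _ _) ⟨
    - (sgnᶠ i * σ) * ((v c * u c′) * det R n (minor₂ B i c (punchOut′ c c′)))
      ≈⟨ -‿distribˡ-* _ _ ⟨
    - pairTerm B i v u c c′ ∎
    where
    σ = sgnᶠ c * sgnᶠ (punchOut′ c c′)
    minor₂-comm : ∀ r s → minor₂ B i c′ (punchOut′ c′ c) r s ≈ minor₂ B i c (punchOut′ c c′) r s
    minor₂-comm r s = reflexive (≡.cong (B (suc (punchIn i r)))
      (punchIn-punchOut′-comm c′ c (c≢c′ ∘ ≡.sym) s))

  det-expand-row : ∀ n (i : Fin (suc n)) (B : Mat (suc n)) →
                   det R (suc n) B ≈ Σ R (suc n) (λ j → B i j * cofactor R B i j)
  det-expand-two-rows : ∀ n (i : Fin (suc n)) (B : Mat (suc (suc n))) →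
                        det R (suc (suc n)) B ≈ offDiagonal (suc n) (pairTerm B i (B zero) (B (suc i)))

  det-expand-row n zero B =
    Σ-cong (suc n) (λ j → x*yz≈y*xz (sgnᶠ j) (B zero j) (det R n (minor R B zero j)))
  det-expand-row zero (suc ()) B
  det-expand-row (suc n) (suc i) B = begin
    det R K B
      ≈⟨ det-expand-two-rows n i B ⟩
    offDiagonal (suc n) (pairTerm B i (B zero) (B (suc i)))
      ≈⟨ Σ-offDiagonal-transpose (suc n) (pairTerm B i (B zero) (B (suc i))) ⟩
    offDiagonal (suc n) (λ c c′ → pairTerm B i (B zero) (B (suc i)) c′ c)
      ≈⟨ Σ-cong K (λ c → Σ-cong (suc n) (λ d →
           pairTerm-antisym B i (B zero) (B (suc i)) (punchInᵢ≢i c d ∘ ≡.sym))) ⟩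
    Σ R K (λ c → Σ R (suc n) (λ d → - pairTerm B i (B (suc i)) (B zero) c (punchIn c d)))
      ≈⟨ Σ-cong K cofactor-term ⟩
    Σ R K (λ c → B (suc i) c * cofactor R B (suc i) c) ∎
    where
    K = suc (suc n)
    rearrange : ∀ s t x b a D → (s * (t * x)) * ((b * a) * D) ≈ (b * (s * t)) * (x * (a * D))
    rearrange = solve 6 (λ s t x b a D →
      (s :* (t :* x)) :* ((b :* a) :* D) := (b :* (s :* t)) :* (x :* (a :* D))) refl
    cofactor-term : ∀ c → Σ R (suc n) (λ d → - pairTerm B i (B (suc i)) (B zero) c (punchIn c d))
                          ≈ B (suc i) c * cofactor R B (suc i) c
    cofactor-term c = begin
      Σ R (suc n) (λ d → - pairTerm B i (B (suc i)) (B zero) c (punchIn c d))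
        ≈⟨ Σ-neg (suc n) (λ d → pairTerm B i (B (suc i)) (B zero) c (punchIn c d)) ⟩
      - Σ R (suc n) (λ d → pairTerm B i (B (suc i)) (B zero) c (punchIn c d))
        ≈⟨ -‿cong (Σ-cong (suc n) (λ d →
             trans (pairTerm-punchIn B i (B (suc i)) (B zero) c d) (rearrange _ _ _ _ _ _))) ⟩
      - Σ R (suc n) (λ d → (b * s) * e d)
        ≈⟨ -‿cong (*-distribˡ-Σ (suc n) _ e) ⟨
      - ((b * s) * Σ R (suc n) e)
        ≈⟨ -‿cong (*-assoc _ _ _) ⟩
      - (b * (s * Σ R (suc n) e))
        ≈⟨ -‿distribʳ-* _ _ ⟩
      b * - (s * Σ R (suc n) e)
        ≈⟨ *-congˡ (-‿distribˡ-* _ _) ⟩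
      b * (- s * Σ R (suc n) e)
        ≈⟨ *-congˡ (*-congʳ (-‿cong (sgn-+ (toℕ i) (toℕ c)))) ⟨
      B (suc i) c * cofactor R B (suc i) c ∎
      where
      b = B (suc i) c
      s = sgnᶠ i * sgnᶠ c
      e : Fin (suc n) → Carrier
      e d = sgnᶠ d * (B zero (punchIn c d) * det R n (minor₂ B i c d))

  det-expand-two-rows n i B = Σ-cong (suc (suc n)) (λ c → begin
    sgnᶠ c * (B zero c * det R (suc n) (minor R B zero c))
      ≈⟨ *-congˡ (*-congˡ (det-expand-row n i (minor R B zero c))) ⟩
    sgnᶠ c * (B zero c * Σ R (suc n) (expansion c))
      ≈⟨ trans (*-congˡ (*-distribˡ-Σ (suc n) (B zero c) (expansion c)))
               (*-distribˡ-Σ (suc n) (sgnᶠ c) (λ d → B zero c * expansion c d)) ⟩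
    Σ R (suc n) (λ d → sgnᶠ c * (B zero c * expansion c d))
      ≈⟨ Σ-cong (suc n) (term c) ⟩
    Σ R (suc n) (λ d → pairTerm B i (B zero) (B (suc i)) c (punchIn c d)) ∎)
    where
    expansion : Fin (suc (suc n)) → Fin (suc n) → Carrier
    expansion c d = B (suc i) (punchIn c d) * cofactor R (minor R B zero c) i d
    rearrange : ∀ a b x s t D → a * (b * (x * ((s * t) * D))) ≈ (s * (a * t)) * ((b * x) * D)
    rearrange = solve 6 (λ a b x s t D →
      a :* (b :* (x :* ((s :* t) :* D))) := (s :* (a :* t)) :* ((b :* x) :* D)) refl
    term : ∀ c d → sgnᶠ c * (B zero c * expansion c d)
                   ≈ pairTerm B i (B zero) (B (suc i)) c (punchIn c d)
    term c d = begin
      sgnᶠ c * (B zero c * (B (suc i) (punchIn c d) * (sgn R (toℕ i +ℕ toℕ d) * det R n (minor₂ B i c d))))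
        ≈⟨ *-congˡ (*-congˡ (*-congˡ (*-congʳ (sgn-+ (toℕ i) (toℕ d))))) ⟩
      sgnᶠ c * (B zero c * (B (suc i) (punchIn c d) * ((sgnᶠ i * sgnᶠ d) * det R n (minor₂ B i c d))))
        ≈⟨ rearrange _ _ _ _ _ _ ⟩
      (sgnᶠ i * (sgnᶠ c * sgnᶠ d)) * ((B zero c * B (suc i) (punchIn c d)) * det R n (minor₂ B i c d))
        ≈⟨ pairTerm-punchIn B i (B zero) (B (suc i)) c d ⟨
      pairTerm B i (B zero) (B (suc i)) c (punchIn c d) ∎

  det-equalRows : ∀ n (j : Fin n) (B : Mat (suc n)) →
                  (∀ s → B (suc j) s ≈ B zero s) → det R (suc n) B ≈ 0#
  det-equalRows zero    () B row≈row₀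
  det-equalRows (suc n) j  B row≈row₀ = begin
    det R (suc (suc n)) B
      ≈⟨ det-expand-two-rows n j B ⟩
    offDiagonal (suc n) (pairTerm B j (B zero) (B (suc j)))
      ≈⟨ Σ-cong (suc (suc n)) (λ c → Σ-cong (suc n) (λ d → use-row₀ c (punchIn c d))) ⟩
    offDiagonal (suc n) (pairTerm B j (B zero) (B zero))
      ≈⟨ Σ-offDiagonal-antisym (suc n) (pairTerm B j (B zero) (B zero)) skew ⟩
    0# ∎
    where
    use-row₀ : ∀ c c′ → pairTerm B j (B zero) (B (suc j)) c c′ ≈ pairTerm B j (B zero) (B zero) c c′
    use-row₀ c c′ = *-congˡ (*-congʳ (*-congˡ (row≈row₀ c′)))
    skew : ∀ c c′ → c ≢ c′ → pairTerm B j (B zero) (B zero) c c′ + pairTerm B j (B zero) (B zero) c′ c ≈ 0#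
    skew c c′ c≢c′ = trans (+-congˡ (pairTerm-antisym B j (B zero) (B zero) c≢c′)) (-‿inverseʳ _)

  det-[]≔ : ∀ n (i : Fin (suc n)) (y : Fin (suc n) → Carrier) (B : Mat (suc n)) →
            det R (suc n) (B [ i ]≔ y) ≈ Σ R (suc n) (λ j → y j * cofactor R B i j)
  det-[]≔ n i y B = trans (det-expand-row n i (B [ i ]≔ y)) (Σ-cong (suc n) term)
    where
    term : ∀ j → (B [ i ]≔ y) i j * cofactor R (B [ i ]≔ y) i j ≈ y j * cofactor R B i j
    term j = *-cong (reflexive (≡.cong-app (updateAt-updates i B) j))
      (*-congˡ (det-cong n (λ r s →
        reflexive (≡.cong-app (updateAt-minimal (punchIn i r) i B (punchInᵢ≢i i r)) (punchIn j s)))))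

  -- The matrix determinant lemma

  outer : ∀ {n} → (Fin n → Carrier) → (Fin n → Carrier) → Mat n
  outer x y r s = x r * y s

  _⊞_ : ∀ {n} → Mat n → Mat n → Mat n
  (A ⊞ B) r s = A r s + B r s

  minor-[]≔ : ∀ {n} (B : Mat (suc n)) (i : Fin n) (y : Fin (suc n) → Carrier) c r s →
              (minor R B zero c [ i ]≔ (y ∘ punchIn c)) r s ≡ minor R (B [ suc i ]≔ y) zero c r s
  minor-[]≔ B i y c r s = ≡.sym (≡.cong-app
    (map-updateAt-local {f = _∘ punchIn c} {g = const y} {h = const (y ∘ punchIn c)} (B ∘ suc) i ≡.refl r) s)

  -- By det-[]≔ this is yᵀ adj(B) x.
  cofactorForm : ∀ {n} → Mat n → (Fin n → Carrier) → (Fin n → Carrier) → Carrier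
  cofactorForm {n} B x y = Σ R n (λ i → x i * det R n (B [ i ]≔ y))

  det-⊞-outer : ∀ n (B : Mat n) (x y : Fin n → Carrier) →
                det R n (B ⊞ outer x y) ≈ det R n B + cofactorForm B x y
  det-⊞-outer zero    B x y = sym (+-identityʳ 1#)
  -- Expand along row 0 and apply the induction hypothesis to the minors; of the
  -- four resulting sums, the one quadratic in y vanishes because its matrices
  -- have two rows equal to y.
  det-⊞-outer (suc n) B x y = begin
    Σ R K (λ c → sgnᶠ c * ((B zero c + x zero * y c) * det R n (minor R (B ⊞ outer x y) zero c)))
      ≈⟨ Σ-cong K (λ c → *-congˡ {sgnᶠ c} (*-congˡ {B zero c + x zero * y c} (minor-expansion c))) ⟩
    Σ R K (λ c → sgnᶠ c * ((B zero c + x zero * y c) * (T c + V c)))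
      ≈⟨ Σ-cong K (λ c → expand (sgnᶠ c) (B zero c) (x zero) (y c) (T c) (V c)) ⟩
    Σ R K (λ c → ((f₁ c + f₂ c) + f₃ c) + f₄ c)
      ≈⟨ Σ-distrib-+ K (λ c → (f₁ c + f₂ c) + f₃ c) f₄ ⟩
    Σ R K (λ c → (f₁ c + f₂ c) + f₃ c) + Σ R K f₄
      ≈⟨ +-congʳ (trans (Σ-distrib-+ K (λ c → f₁ c + f₂ c) f₃) (+-congʳ (Σ-distrib-+ K f₁ f₂))) ⟩
    ((Σ R K f₁ + Σ R K f₂) + Σ R K f₃) + Σ R K f₄
      ≈⟨ +-cong (+-cong (+-congˡ Σf₂) Σf₃) Σf₄ ⟩
    ((det R K B + Q) + x zero * det R K (B [ zero ]≔ y)) + 0#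
      ≈⟨ collect (det R K B) Q (x zero * det R K (B [ zero ]≔ y)) ⟩
    det R K B + (x zero * det R K (B [ zero ]≔ y) + Q) ∎
    where
    K = suc n
    T : Fin K → Carrier
    T c = det R n (minor R B zero c)
    U : Fin K → Fin n → Carrier
    U c i = det R n (minor R (B [ suc i ]≔ y) zero c)
    V : Fin K → Carrier
    V c = Σ R n (λ i → x (suc i) * U c i)
    Q = Σ R n (λ i → x (suc i) * det R K (B [ suc i ]≔ y))
    minor-expansion : ∀ c → det R n (minor R (B ⊞ outer x y) zero c) ≈ T c + V c
    minor-expansion c = trans (det-⊞-outer n (minor R B zero c) (x ∘ suc) (y ∘ punchIn c))
      (+-congˡ (Σ-cong n (λ i → *-congˡ (det-cong n (λ r s → reflexive (minor-[]≔ B i y c r s))))))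
    f₁ f₂ f₃ f₄ : Fin K → Carrier
    f₁ c = sgnᶠ c * (B zero c * T c)
    f₂ c = sgnᶠ c * (B zero c * V c)
    f₃ c = x zero * (sgnᶠ c * (y c * T c))
    f₄ c = x zero * (sgnᶠ c * (y c * V c))
    expand : ∀ s b x₀ y T V →
      s * ((b + x₀ * y) * (T + V)) ≈ ((s * (b * T) + s * (b * V)) + x₀ * (s * (y * T))) + x₀ * (s * (y * V))
    expand = solve 6 (λ s b x₀ y T V → s :* ((b :+ x₀ :* y) :* (T :+ V))
      := ((s :* (b :* T) :+ s :* (b :* V)) :+ x₀ :* (s :* (y :* T))) :+ x₀ :* (s :* (y :* V))) refl
    collect : ∀ d q p → ((d + q) + p) + 0# ≈ d + (p + q)
    collect = solve 3 (λ d q p → ((d :+ q) :+ p) :+ con 0 := d :+ (p :+ q)) refl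
    Σf₂ : Σ R K f₂ ≈ Q
    Σf₂ = Σ-interchange K n sgnᶠ (B zero) (x ∘ suc) U
    Σf₃ : Σ R K f₃ ≈ x zero * det R K (B [ zero ]≔ y)
    Σf₃ = sym (*-distribˡ-Σ K (x zero) (λ c → sgnᶠ c * (y c * T c)))
    Σf₄ : Σ R K f₄ ≈ 0#
    Σf₄ = begin
      Σ R K f₄
        ≈⟨ *-distribˡ-Σ K (x zero) (λ c → sgnᶠ c * (y c * V c)) ⟨
      x zero * Σ R K (λ c → sgnᶠ c * (y c * V c))
        ≈⟨ *-congˡ (Σ-interchange K n sgnᶠ y (x ∘ suc) U) ⟩
      x zero * Σ R n (λ i → x (suc i) * det R K ((B [ suc i ]≔ y) [ zero ]≔ y))
        ≈⟨ *-congˡ (Σ-zero n _ (λ i → trans (*-congˡ (det-equalRows-y i)) (zeroʳ _))) ⟩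
      x zero * 0#
        ≈⟨ zeroʳ _ ⟩
      0# ∎
      where
      det-equalRows-y : ∀ i → det R K ((B [ suc i ]≔ y) [ zero ]≔ y) ≈ 0#
      det-equalRows-y i = det-equalRows n i ((B [ suc i ]≔ y) [ zero ]≔ y)
        (λ s → reflexive (≡.cong-app (updateAt-updates i (B ∘ suc)) s))

  -- Invariance of the cofactor sum

  𝟙 : ∀ {n} → Fin n → Carrier
  𝟙 _ = 1#

  cofsum≈cofactorForm : ∀ n (B : Mat n) → cofsum R n B ≈ cofactorForm B 𝟙 𝟙
  cofsum≈cofactorForm zero    B = refl
  cofsum≈cofactorForm (suc n) B =
    trans (Σ-comm (suc n) (suc n) (λ i j → cofactor R B j i)) (Σ-cong (suc n) row-sum)
    where
    row-sum : ∀ j → Σ R (suc n) (cofactor R B j) ≈ 1# * det R (suc n) (B [ j ]≔ 𝟙)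
    row-sum j = begin
      Σ R (suc n) (cofactor R B j)                 ≈⟨ Σ-cong (suc n) (λ i → *-identityˡ (cofactor R B j i)) ⟨
      Σ R (suc n) (λ i → 1# * cofactor R B j i)    ≈⟨ det-[]≔ n j 𝟙 B ⟨
      det R (suc n) (B [ j ]≔ 𝟙)                    ≈⟨ *-identityˡ _ ⟨
      1# * det R (suc n) (B [ j ]≔ 𝟙)               ∎

  det-[]≔-+ : ∀ n (i : Fin (suc n)) (y y′ : Fin (suc n) → Carrier) (B : Mat (suc n)) →
              det R (suc n) (B [ i ]≔ (λ j → y j + y′ j))
              ≈ det R (suc n) (B [ i ]≔ y) + det R (suc n) (B [ i ]≔ y′)
  det-[]≔-+ n i y y′ B = begin
    det R (suc n) (B [ i ]≔ (λ j → y j + y′ j))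
      ≈⟨ det-[]≔ n i _ B ⟩
    Σ R (suc n) (λ j → (y j + y′ j) * cofactor R B i j)
      ≈⟨ Σ-cong (suc n) (λ j → distribʳ (cofactor R B i j) (y j) (y′ j)) ⟩
    Σ R (suc n) (λ j → y j * cofactor R B i j + y′ j * cofactor R B i j)
      ≈⟨ Σ-distrib-+ (suc n) (λ j → y j * cofactor R B i j) (λ j → y′ j * cofactor R B i j) ⟩
    Σ R (suc n) (λ j → y j * cofactor R B i j) + Σ R (suc n) (λ j → y′ j * cofactor R B i j)
      ≈⟨ +-cong (det-[]≔ n i y B) (det-[]≔ n i y′ B) ⟨
    det R (suc n) (B [ i ]≔ y) + det R (suc n) (B [ i ]≔ y′) ∎

  cofactorForm-+ˡ : ∀ n (B : Mat n) (x x′ y : Fin n → Carrier) →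
    cofactorForm B (λ i → x i + x′ i) y ≈ cofactorForm B x y + cofactorForm B x′ y
  cofactorForm-+ˡ n B x x′ y = trans (Σ-cong n (λ i → distribʳ _ (x i) (x′ i)))
    (Σ-distrib-+ n (λ i → x i * det R n (B [ i ]≔ y)) (λ i → x′ i * det R n (B [ i ]≔ y)))

  cofactorForm-+ʳ : ∀ n (B : Mat n) (x y y′ : Fin n → Carrier) →
    cofactorForm B x (λ j → y j + y′ j) ≈ cofactorForm B x y + cofactorForm B x y′
  cofactorForm-+ʳ zero    B x y y′ = sym (+-identityʳ 0#)
  cofactorForm-+ʳ (suc n) B x y y′ =
    trans (Σ-cong (suc n) (λ i → trans (*-congˡ (det-[]≔-+ n i y y′ B)) (distribˡ (x i) _ _)))
      (Σ-distrib-+ (suc n) (λ i → x i * det R (suc n) (B [ i ]≔ y)) (λ i → x i * det R (suc n) (B [ i ]≔ y′)))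

  cofsum-shiftRows : ∀ n (B B′ : Mat n) (u : Fin n → Carrier) →
                     (∀ r s → B′ r s ≈ B r s + u r) → cofsum R n B′ ≈ cofsum R n B
  cofsum-shiftRows n B B′ u B′≈B+u = +-cancelˡ (det R n B′) _ _ (begin
    det R n B′ + cofsum R n B′
      ≈⟨ +-congˡ (cofsum≈cofactorForm n B′) ⟩
    det R n B′ + cofactorForm B′ 𝟙 𝟙
      ≈⟨ det-⊞-outer n B′ 𝟙 𝟙 ⟨
    det R n (B′ ⊞ outer 𝟙 𝟙)
      ≈⟨ det-cong n (λ r s → trans (+-congʳ (B′≈B+u r s)) (regroup (B r s) (u r))) ⟩
    det R n (B ⊞ outer (λ r → u r + 1#) 𝟙)
      ≈⟨ det-⊞-outer n B (λ r → u r + 1#) 𝟙 ⟩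
    det R n B + cofactorForm B (λ r → u r + 1#) 𝟙
      ≈⟨ +-congˡ (cofactorForm-+ˡ n B u 𝟙 𝟙) ⟩
    det R n B + (cofactorForm B u 𝟙 + cofactorForm B 𝟙 𝟙)
      ≈⟨ +-assoc _ _ _ ⟨
    (det R n B + cofactorForm B u 𝟙) + cofactorForm B 𝟙 𝟙
      ≈⟨ +-cong (det-⊞-outer n B u 𝟙) (cofsum≈cofactorForm n B) ⟨
    det R n (B ⊞ outer u 𝟙) + cofsum R n B
      ≈⟨ +-congʳ (det-cong n (λ r s → trans (+-congˡ (*-identityʳ (u r))) (sym (B′≈B+u r s)))) ⟩
    det R n B′ + cofsum R n B ∎)
    where
    regroup : ∀ b u → (b + u) + 1# * 1# ≈ b + (u + 1#) * 1#
    regroup = solve 2 (λ b u → (b :+ u) :+ con 1 :* con 1 := b :+ (u :+ con 1) :* con 1) refl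

  cofsum-shiftColumns : ∀ n (B B′ : Mat n) (v : Fin n → Carrier) →
                        (∀ r s → B′ r s ≈ B r s + v s) → cofsum R n B′ ≈ cofsum R n B
  cofsum-shiftColumns n B B′ v B′≈B+v = +-cancelˡ (det R n B′) _ _ (begin
    det R n B′ + cofsum R n B′
      ≈⟨ +-congˡ (cofsum≈cofactorForm n B′) ⟩
    det R n B′ + cofactorForm B′ 𝟙 𝟙
      ≈⟨ det-⊞-outer n B′ 𝟙 𝟙 ⟨
    det R n (B′ ⊞ outer 𝟙 𝟙)
      ≈⟨ det-cong n (λ r s → trans (+-congʳ (B′≈B+v r s)) (regroup (B r s) (v s))) ⟩
    det R n (B ⊞ outer 𝟙 (λ s → v s + 1#))
      ≈⟨ det-⊞-outer n B 𝟙 (λ s → v s + 1#) ⟩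
    det R n B + cofactorForm B 𝟙 (λ s → v s + 1#)
      ≈⟨ +-congˡ (cofactorForm-+ʳ n B 𝟙 v 𝟙) ⟩
    det R n B + (cofactorForm B 𝟙 v + cofactorForm B 𝟙 𝟙)
      ≈⟨ +-assoc _ _ _ ⟨
    (det R n B + cofactorForm B 𝟙 v) + cofactorForm B 𝟙 𝟙
      ≈⟨ +-cong (det-⊞-outer n B 𝟙 v) (cofsum≈cofactorForm n B) ⟨
    det R n (B ⊞ outer 𝟙 v) + cofsum R n B
      ≈⟨ +-congʳ (det-cong n (λ r s → trans (+-congˡ (*-identityˡ (v s))) (sym (B′≈B+v r s)))) ⟩
    det R n B′ + cofsum R n B ∎)
    where
    regroup : ∀ b v → (b + v) + 1# * 1# ≈ b + 1# * (v + 1#)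
    regroup = solve 2 (λ b v → (b :+ v) :+ con 1 :* con 1 := b :+ con 1 :* (v :+ con 1)) refl

  centering-⊗ : ∀ n ν (X : Mat n) i j →
                _⊗_ R (centering R n ν) X i j ≈ X i j + Σ R n (λ l → - ν * X l j)
  centering-⊗ n ν X i j = trans (Σ-cong n (λ l → distribʳ (X l j) (δ R i l) (- ν)))
    (trans (Σ-distrib-+ n (λ l → δ R i l * X l j) (λ l → - ν * X l j)) (+-congʳ (Σ-δˡ n i (λ l → X l j))))

  ⊗-centering : ∀ n ν (X : Mat n) i j →
                _⊗_ R X (centering R n ν) i j ≈ X i j + Σ R n (λ k → X i k * - ν)
  ⊗-centering n ν X i j = trans (Σ-cong n (λ k → distribˡ (X i k) (δ R k j) (- ν)))
    (trans (Σ-distrib-+ n (λ k → X i k * δ R k j) (λ k → X i k * - ν)) (+-congʳ (Σ-δʳ n j (X i))))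

  cofsum-submatrix-centered : ∀ n ν (A : Mat n) k (f g : Fin k → Fin n) →
    cofsum R k (submatrix R (centered R n ν A) f g) ≈ cofsum R k (submatrix R A f g)
  cofsum-submatrix-centered n ν A k f g = trans
    (cofsum-shiftRows k (submatrix R PA f g) _ (λ r → Σ R n (λ l → PA (f r) l * - ν))
      (λ r s → ⊗-centering n ν PA (f r) (g s)))
    (cofsum-shiftColumns k (submatrix R A f g) _ (λ s → Σ R n (λ l → - ν * A l (g s)))
      (λ r s → centering-⊗ n ν A (f r) (g s)))
    where
    PA : Mat n
    PA = _⊗_ R (centering R n ν) A

lemma5p3 : ∀ {c ℓ : Level} (R : CommutativeRing c ℓ) (n : ℕ)
           (ninv : CommutativeRing.Carrier R)
           → CommutativeRing._≈_ R (CommutativeRing._*_ R (fromℕ R n) ninv) (CommutativeRing.1# R)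
           → (A : Matrix (CommutativeRing.Carrier R) n n)
           → (k : ℕ) (Ω₁ Ω₂ : Fin (suc k) → Fin n)
           → StrictlyIncreasing Ω₁ → StrictlyIncreasing Ω₂
           → CommutativeRing._≈_ R (cofsum R n A) (cofsum R n (centered R n ninv A))
             × CommutativeRing._≈_ R (cofsum R (suc k) (submatrix R A Ω₁ Ω₂))
                 (cofsum R (suc k) (submatrix R (centered R n ninv A) Ω₁ Ω₂))
lemma5p3 R n ninv _ A k Ω₁ Ω₂ _ _ =
    sym (cofsum-submatrix-centered n ninv A n id id)
  , sym (cofsum-submatrix-centered n ninv A (suc k) Ω₁ Ω₂)
  where
  open Cofactors R
  open CommutativeRing R using (sym)
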